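{- Let $\mathcal{V}$ be an $n$-dimensional $(s,h)$-dual subspace design of size $m$, and let $f:\{0,1\}^n\to\{0,1\}$ be defined by $f^{ -1}(1)=\bigcup_{V\in\mathcal{V}}V$. If $\epsilon < \frac{m-h}{8m}\cdot\frac{|f^{ -1}(0)|}{2^n}$, then the $\epsilon$-error randomized parity decision tree complexity of $f$ is at least $s$.
   Context: An $n$-dimensional $(s,h)$-subspace design is a set of subspaces $\{S_1,\dots,S_m\}$ of $\mathbb{F}_2^n$ such that for every subspace $T$ of dimension at most $s$, at most $h$ of the $S_i$ satisfy $S_i\cap T\ne\{0\}$. A set $\{V_1,\dots,V_m\}$ is an $(s,h)$-dual subspace design if the dual spaces $V_i^\perp=\{\ell:\langle\ell,x\rangle=0\ \forall x\in V_i\}$ form an $(s,h)$-subspace design. A parity decision tree is a rooted binary tree in which each internal node is labelled by a set $S\subseteq[n]$ and queries $\bigoplus_{i\in S}x_i$; leaves are labelled by output bits; its cost is its height. A randomized parity decision tree of cost $c$ is a distribution over deterministic parity decision trees of cost $c$; the $\epsilon$-error randomized parity decision tree complexity of $f$ is the minimum cost of one satisfying $\Pr[T(x)=f(x)]\ge1-\epsilon$ for all $x$.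
   Formalization: The error ε is rational, and the probability weights of the randomized parity decision trees are taken in the rationals. -}

module Defs where

open import Data.Bool using (Bool; true; false; _xor_; _∧_; if_then_else_)
open import Data.Nat as ℕ using (ℕ; zero; suc)
open import Data.Fin using (Fin)
open import Data.Vec using (Vec; []; _∷_; replicate; zipWith; foldr; map)
open import Data.List as L using (List; []; _∷_; _++_)
open import Data.Product using (Σ; ∃; _×_; _,_; proj₁; proj₂)
open import Data.Integer using (+_)
open import Data.Rational as Q using (ℚ; 0ℚ; 1ℚ; _/_)
open import Relation.Binary.PropositionalEquality using (_≡_)
open import Relation.Nullary using (¬_)
open import Function.Definitions using (Injective)
open import Function.Base using (_∘_)
open import Data.List.Relation.Unary.All using (All)

-- Vectors of F₂ⁿ (true = 1, false = 0)
𝔽₂^ : ℕ → Set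
𝔽₂^ n = Vec Bool n

𝟎 : ∀ {n} → 𝔽₂^ n
𝟎 {n} = replicate n false

_⊕_ : ∀ {n} → 𝔽₂^ n → 𝔽₂^ n → 𝔽₂^ n
_⊕_ = zipWith _xor_

_·_ : Bool → ∀ {n} → 𝔽₂^ n → 𝔽₂^ n
b · v = map (b ∧_) v

⟨_,_⟩ : ∀ {n} → 𝔽₂^ n → 𝔽₂^ n → Bool
⟨ l , x ⟩ = foldr _ _xor_ false (zipWith _∧_ l x)

allVecs : (n : ℕ) → List (𝔽₂^ n)
allVecs zero = [] ∷ []
allVecs (suc n) = L.map (false ∷_) (allVecs n) ++ L.map (true ∷_) (allVecs n)

lincomb : ∀ {n k} → (Fin k → Bool) → (Fin k → 𝔽₂^ n) → 𝔽₂^ n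
lincomb {n} {zero} c g = 𝟎
lincomb {n} {suc k} c g = (c Fin.zero · g Fin.zero) ⊕ lincomb (c ∘ Fin.suc) (g ∘ Fin.suc)
  where import Data.Fin as Fin

-- A subspace of F₂ⁿ, presented by a finite family of generators (its span).
record Subspace (n : ℕ) : Set where
  constructor span
  field
    k   : ℕ
    gen : Fin k → 𝔽₂^ n

_∈S_ : ∀ {n} → 𝔽₂^ n → Subspace n → Set
x ∈S span k g = Σ (Fin k → Bool) λ c → x ≡ lincomb c g

_∈⊥_ : ∀ {n} → 𝔽₂^ n → Subspace n → Set
l ∈⊥ V = ∀ x → x ∈S V → ⟨ l , x ⟩ ≡ false

MeetsNontrivially : ∀ {n} → (𝔽₂^ n → Set) → Subspace n → Set
MeetsNontrivially S T = ∃ λ y → ¬ (y ≡ 𝟎) × S y × y ∈S T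

-- Subspaces T of dimension ≤ s are exactly the spans of s vectors.
-- "at most h of the S_i meet T nontrivially": no h+1 distinct indices all do.
IsSubspaceDesign : ∀ {n m} → (s h : ℕ) → (Fin m → 𝔽₂^ n → Set) → Set
IsSubspaceDesign {n} {m} s h S =
  (t : Fin s → 𝔽₂^ n) → (ι : Fin (suc h) → Fin m) → Injective _≡_ _≡_ ι →
  ¬ (∀ j → MeetsNontrivially (S (ι j)) (span s t))

IsDualSubspaceDesign : ∀ {n m} → (s h : ℕ) → (Fin m → Subspace n) → Set
IsDualSubspaceDesign s h V = IsSubspaceDesign s h (λ i l → l ∈⊥ V i)

-- Parity decision trees: node S queries ⊕_{i∈S} x_i (S as indicator vector);
-- left subtree on answer 0, right subtree on answer 1.
data PDT (n : ℕ) : Set where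
  leaf : Bool → PDT n
  node : 𝔽₂^ n → PDT n → PDT n → PDT n

eval : ∀ {n} → PDT n → 𝔽₂^ n → Bool
eval (leaf b) x = b
eval (node S l r) x = if ⟨ S , x ⟩ then eval r x else eval l x

height : ∀ {n} → PDT n → ℕ
height (leaf _) = 0
height (node _ l r) = suc (height l ℕ.⊔ height r)

ℕ→ℚ : ℕ → ℚ
ℕ→ℚ k = + k / 1

boolEq : Bool → Bool → Bool
boolEq true true = true
boolEq false false = true
boolEq _ _ = false

-- A randomized parity decision tree: finite distribution (rational weights)
-- over deterministic parity decision trees.
RPDT : ℕ → Set
RPDT n = List (ℚ × PDT n)

sumℚ : List ℚ → ℚ
sumℚ = L.foldr Q._+_ 0ℚ

IsDistribution : ∀ {n} → RPDT n → Set
IsDistribution D = All (λ p → 0ℚ Q.≤ proj₁ p) D × sumℚ (L.map proj₁ D) ≡ 1ℚ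

CostBelow : ∀ {n} → ℕ → RPDT n → Set
CostBelow c D = All (λ p → height (proj₂ p) ℕ.< c) D

successProb : ∀ {n} → RPDT n → 𝔽₂^ n → Bool → ℚ
successProb D x b = sumℚ (L.map (λ p → if boolEq (eval (proj₂ p) x) b then proj₁ p else 0ℚ) D)

ComputesWithError : ∀ {n} → (𝔽₂^ n → Bool) → ℚ → RPDT n → Set
ComputesWithError {n} f ε D = ∀ (x : 𝔽₂^ n) → 1ℚ Q.- ε Q.≤ successProb D x (f x)

zeroCount : ∀ {n} → (𝔽₂^ n → Bool) → ℕ
zeroCount {n} f = L.length (L.filterᵇ (λ x → boolEq (f x) false) (allVecs n))

{-# OPTIONS --safe #-}
module Submission where

-- Yao's principle with an explicit hard input distribution μ: weight m on every zero of f, and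
-- weight 2ⁿ/2^k on each of the 2^k listed points of every V i.  A randomised tree with error ε
-- errs on μ-mass at most ε·μ(𝔽₂ⁿ) ≤ 2m·2ⁿ·ε in expectation.  Conversely, a leaf of a parity
-- decision tree of depth < s is an affine subspace A cut out by fewer than s parities ℓⱼ.  By the
-- design property, for all but h indices i the span of the ℓⱼ meets V i^⊥ trivially, and then a
-- Fourier computation shows that V i is equidistributed over A: μ(A ∩ V i) = |A|.  So a leaf
-- answering 0 pays at least (m − h)·|A|, a leaf answering 1 pays m·|A ∩ f⁻¹(0)|, and every tree
-- errs on μ-mass at least (m − h)·|f⁻¹(0)|.

open import Defs
open import Algebra.Bundles using (CommutativeRing)
import Algebra.Properties.CommutativeSemigroup as CommutativeSemigroupProperties
open import Data.Bool using (Bool; true; false; _xor_; _∧_; not; if_then_else_; _≟_)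
open import Data.Bool.Properties using (xor-assoc; xor-identityˡ; xor-identityʳ; xor-∧-commutativeRing; ∧-comm; ∧-distribˡ-xor; ∧-distribʳ-xor; ∧-zeroʳ; ∧-identityʳ; T-not-≡)
open import Data.Empty using (⊥-elim)
open import Data.Fin as Fin using (Fin)
import Data.Integer as ℤ
import Data.Integer.Properties as ℤP
open import Data.List as L using (List; []; _∷_; _++_)
open import Data.List.Membership.Propositional using (_∈_)
open import Data.List.Membership.Propositional.Properties using (∈-filter⁻)
open import Data.List.Properties using (length-++; length-map; length-tabulate; map-∘)
open import Data.List.Relation.Unary.All as All using (All; []; _∷_)
open import Data.List.Relation.Unary.AllPairs using ([]; _∷_)
open import Data.List.Relation.Unary.Any using (here; there)
open import Data.List.Relation.Unary.Unique.Propositional using (Unique)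
open import Data.List.Relation.Unary.Unique.Propositional.Properties using (filter⁺; allFin⁺)
open import Data.Nat using (ℕ; _^_)
open import Data.Nat as ℕ using (zero; suc)
import Data.Nat.Coprimality as Coprime
import Data.Nat.Properties as ℕP
open import Data.Product using (Σ; ∃; _×_; _,_; proj₁; proj₂)
open import Data.Rational using (ℚ; 0ℚ; 1ℚ; ½; mkℚ; _/_; _+_; _*_; _-_; -_; _≤_; _<_; 1/_; *≤*; *<*; nonNegative; positive; >-nonZero)
import Data.Rational.Properties as ℚP
open import Data.Rational.Solver using (module +-*-Solver)
open +-*-Solver using (solve; _:+_; _:*_; :-_; con; _:=_)
open import Data.Vec using ([]; _∷_; tabulate; lookup)
import Data.Vec.Functional as VF
open import Data.Vec.Properties using (map-const; map-id; ≡-dec; tabulate∘lookup)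
open import Data.Vec.Relation.Binary.Pointwise.Inductive using (Pointwise-≡⇒≡; zipWith-assoc; zipWith-identityˡ; zipWith-identityʳ)
open import Function.Base using (_∘_; case_of_)
open import Function.Bundles using (_⇔_; Equivalence)
open import Function.Definitions using (Injective)
open import Relation.Binary.PropositionalEquality using (_≡_; refl; sym; trans; cong; cong₂; subst; subst₂; module ≡-Reasoning)
open import Relation.Nullary using (¬_; yes; no)
open import Relation.Nullary.Decidable using (T?; does; dec-true; decidable-stable)

open CommutativeSemigroupProperties (CommutativeRing.+-commutativeSemigroup xor-∧-commutativeRing)
  using () renaming (interchange to xor-interchange)

-- Linear algebra over 𝔽₂

⊕-assoc : ∀ {n} (a b c : 𝔽₂^ n) → (a ⊕ b) ⊕ c ≡ a ⊕ (b ⊕ c)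
⊕-assoc a b c = Pointwise-≡⇒≡ (zipWith-assoc xor-assoc a b c)

⊕-identityˡ : ∀ {n} (a : 𝔽₂^ n) → 𝟎 ⊕ a ≡ a
⊕-identityˡ a = Pointwise-≡⇒≡ (zipWith-identityˡ xor-identityˡ a)

⊕-identityʳ : ∀ {n} (a : 𝔽₂^ n) → a ⊕ 𝟎 ≡ a
⊕-identityʳ a = Pointwise-≡⇒≡ (zipWith-identityʳ xor-identityʳ a)

·-zeroˡ : ∀ {n} (v : 𝔽₂^ n) → false · v ≡ 𝟎
·-zeroˡ v = map-const v false

·-identityˡ : ∀ {n} (v : 𝔽₂^ n) → true · v ≡ v
·-identityˡ = map-id

inner-⊕ˡ : ∀ {n} (a b x : 𝔽₂^ n) → ⟨ a ⊕ b , x ⟩ ≡ ⟨ a , x ⟩ xor ⟨ b , x ⟩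
inner-⊕ˡ [] [] [] = refl
inner-⊕ˡ (a ∷ as) (b ∷ bs) (x ∷ xs) =
  trans (cong₂ _xor_ (∧-distribʳ-xor x a b) (inner-⊕ˡ as bs xs))
        (xor-interchange (a ∧ x) (b ∧ x) ⟨ as , xs ⟩ ⟨ bs , xs ⟩)

inner-⊕ʳ : ∀ {n} (ℓ a b : 𝔽₂^ n) → ⟨ ℓ , a ⊕ b ⟩ ≡ ⟨ ℓ , a ⟩ xor ⟨ ℓ , b ⟩
inner-⊕ʳ [] [] [] = refl
inner-⊕ʳ (l ∷ ls) (a ∷ as) (b ∷ bs) =
  trans (cong₂ _xor_ (∧-distribˡ-xor l a b) (inner-⊕ʳ ls as bs))
        (xor-interchange (l ∧ a) (l ∧ b) ⟨ ls , as ⟩ ⟨ ls , bs ⟩)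

inner-𝟎ˡ : ∀ {n} (x : 𝔽₂^ n) → ⟨ 𝟎 , x ⟩ ≡ false
inner-𝟎ˡ [] = refl
inner-𝟎ˡ (_ ∷ xs) = inner-𝟎ˡ xs

inner-𝟎ʳ : ∀ {n} (ℓ : 𝔽₂^ n) → ⟨ ℓ , 𝟎 ⟩ ≡ false
inner-𝟎ʳ [] = refl
inner-𝟎ʳ (l ∷ ls) = trans (cong (_xor ⟨ ls , 𝟎 ⟩) (∧-comm l false)) (inner-𝟎ʳ ls)

inner-·ʳ : ∀ {n} (ℓ : 𝔽₂^ n) c v → ⟨ ℓ , c · v ⟩ ≡ c ∧ ⟨ ℓ , v ⟩
inner-·ʳ ℓ true v = cong ⟨ ℓ ,_⟩ (·-identityˡ v)
inner-·ʳ ℓ false v = trans (cong ⟨ ℓ ,_⟩ (·-zeroˡ v)) (inner-𝟎ʳ ℓ)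

onGenerators : ∀ {n k} → 𝔽₂^ n → (Fin k → 𝔽₂^ n) → 𝔽₂^ k
onGenerators ℓ g = tabulate λ j → ⟨ ℓ , g j ⟩

inner-lincomb : ∀ {n k} (ℓ : 𝔽₂^ n) (c : Fin k → Bool) (g : Fin k → 𝔽₂^ n) →
  ⟨ ℓ , lincomb c g ⟩ ≡ ⟨ onGenerators ℓ g , tabulate c ⟩
inner-lincomb {k = zero} ℓ c g = inner-𝟎ʳ ℓ
inner-lincomb {k = suc k} ℓ c g =
  trans (inner-⊕ʳ ℓ (c Fin.zero · g Fin.zero) (lincomb (c ∘ Fin.suc) (g ∘ Fin.suc)))
        (cong₂ _xor_ (trans (inner-·ʳ ℓ (c Fin.zero) (g Fin.zero)) (∧-comm (c Fin.zero) _))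
                     (inner-lincomb ℓ (c ∘ Fin.suc) (g ∘ Fin.suc)))

onGenerators≡𝟎⇒∈⊥ : ∀ {n k} (ℓ : 𝔽₂^ n) (g : Fin k → 𝔽₂^ n) →
  onGenerators ℓ g ≡ 𝟎 → ℓ ∈⊥ span k g
onGenerators≡𝟎⇒∈⊥ ℓ g ℓg≡𝟎 x (c , refl) =
  trans (inner-lincomb ℓ c g) (trans (cong ⟨_, tabulate c ⟩ ℓg≡𝟎) (inner-𝟎ˡ (tabulate c)))

-- Cosets of spans and the design property

data _∈_+⟨_⟩ {n : ℕ} : 𝔽₂^ n → 𝔽₂^ n → List (𝔽₂^ n) → Set where
  base : ∀ {u} → u ∈ u +⟨ [] ⟩
  skip : ∀ {u ℓ₀ ℓ ℓs} → u ∈ ℓ₀ +⟨ ℓs ⟩ → u ∈ ℓ₀ +⟨ ℓ ∷ ℓs ⟩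
  add  : ∀ {u ℓ₀ ℓ ℓs} → u ∈ ℓ₀ ⊕ ℓ +⟨ ℓs ⟩ → u ∈ ℓ₀ +⟨ ℓ ∷ ℓs ⟩

pad : ∀ {n} (s : ℕ) → List (𝔽₂^ n) → Fin s → 𝔽₂^ n
pad (suc s) (ℓ ∷ ℓs) Fin.zero = ℓ
pad (suc s) (ℓ ∷ ℓs) (Fin.suc j) = pad s ℓs j
pad (suc s) [] j = 𝟎
pad zero ℓs ()

lincomb-false : ∀ {n k} (g : Fin k → 𝔽₂^ n) → lincomb (λ _ → false) g ≡ 𝟎
lincomb-false {k = zero} g = refl
lincomb-false {k = suc k} g =
  trans (cong₂ _⊕_ (·-zeroˡ (g Fin.zero)) (lincomb-false (g ∘ Fin.suc))) (⊕-identityˡ 𝟎)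

∈+⟨⟩⇒lincomb : ∀ {n} s {u ℓ₀ : 𝔽₂^ n} {ℓs} → u ∈ ℓ₀ +⟨ ℓs ⟩ → L.length ℓs ℕ.≤ s →
  Σ (Fin s → Bool) λ c → u ≡ ℓ₀ ⊕ lincomb c (pad s ℓs)
∈+⟨⟩⇒lincomb s {u} base _ =
  (λ _ → false) , sym (trans (cong (u ⊕_) (lincomb-false (pad s []))) (⊕-identityʳ u))
∈+⟨⟩⇒lincomb (suc s) {ℓ₀ = ℓ₀} {ℓ ∷ ℓs} (skip u∈) (ℕ.s≤s len≤s) with ∈+⟨⟩⇒lincomb s u∈ len≤s
... | c , u≡ = (false VF.∷ c) ,
  trans u≡ (cong (ℓ₀ ⊕_) (sym (trans (cong (_⊕ _) (·-zeroˡ ℓ)) (⊕-identityˡ _))))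
∈+⟨⟩⇒lincomb (suc s) {ℓ₀ = ℓ₀} {ℓ ∷ ℓs} (add u∈) (ℕ.s≤s len≤s) with ∈+⟨⟩⇒lincomb s u∈ len≤s
... | c , u≡ = (true VF.∷ c) ,
  trans u≡ (trans (⊕-assoc ℓ₀ ℓ _) (cong (λ v → ℓ₀ ⊕ (v ⊕ _)) (sym (·-identityˡ ℓ))))

Avoids : ∀ {n} → Subspace n → 𝔽₂^ n → List (𝔽₂^ n) → Set
Avoids V ℓ₀ ℓs = ∀ {u} → u ∈ ℓ₀ +⟨ ℓs ⟩ → u ∈⊥ V → u ≡ 𝟎

¬¬-∀ : ∀ {k} {P : Fin k → Set} → (∀ j → ¬ ¬ P j) → ¬ ¬ (∀ j → P j)
¬¬-∀ {zero} _ ¬all = ¬all λ ()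
¬¬-∀ {suc k} ¬¬P ¬all =
  ¬¬P Fin.zero λ p₀ → ¬¬-∀ (¬¬P ∘ Fin.suc) λ ps → ¬all λ { Fin.zero → p₀ ; (Fin.suc j) → ps j }

¬Avoids⇒¬¬Meets : ∀ {n} s (V : Subspace n) {ℓs} → L.length ℓs ℕ.≤ s → ¬ Avoids V 𝟎 ℓs →
  ¬ ¬ MeetsNontrivially (_∈⊥ V) (span s (pad s ℓs))
¬Avoids⇒¬¬Meets s V len≤s ¬avoids ¬meets = ¬avoids λ {u} u∈ u⊥ →
  decidable-stable (≡-dec _≟_ u 𝟎) λ u≢𝟎 →
    let c , u≡ = ∈+⟨⟩⇒lincomb s u∈ len≤s in ¬meets (u , u≢𝟎 , u⊥ , c , trans u≡ (⊕-identityˡ _))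

-- Rationals and finite sums

ℕ→ℚ≡mkℚ : ∀ k → ℕ→ℚ k ≡ mkℚ (ℤ.+ k) 0 (Coprime.sym (Coprime.1-coprimeTo k))
ℕ→ℚ≡mkℚ k = ℚP.normalize-coprime (Coprime.sym (Coprime.1-coprimeTo k))

ℕ→ℚ-+ : ∀ a b → ℕ→ℚ (a ℕ.+ b) ≡ ℕ→ℚ a + ℕ→ℚ b
ℕ→ℚ-+ a b rewrite ℕ→ℚ≡mkℚ a | ℕ→ℚ≡mkℚ b =
  cong (_/ 1) (trans (ℤP.pos-+ a b) (sym (cong₂ ℤ._+_ (ℤP.*-identityʳ (ℤ.+ a)) (ℤP.*-identityʳ (ℤ.+ b)))))

ℕ→ℚ-* : ∀ a b → ℕ→ℚ (a ℕ.* b) ≡ ℕ→ℚ a * ℕ→ℚ b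
ℕ→ℚ-* a b rewrite ℕ→ℚ≡mkℚ a | ℕ→ℚ≡mkℚ b = cong (_/ 1) (ℤP.pos-* a b)

ℕ→ℚ-mono-≤ : ∀ {a b} → a ℕ.≤ b → ℕ→ℚ a ≤ ℕ→ℚ b
ℕ→ℚ-mono-≤ {a} {b} a≤b rewrite ℕ→ℚ≡mkℚ a | ℕ→ℚ≡mkℚ b =
  *≤* (ℤP.*-monoʳ-≤-nonNeg (ℤ.+ 1) (ℤ.+≤+ a≤b))

ℕ→ℚ-nonNeg : ∀ k → 0ℚ ≤ ℕ→ℚ k
ℕ→ℚ-nonNeg k = ℕ→ℚ-mono-≤ {0} {k} ℕ.z≤n

*-nonNeg : ∀ {a b} → 0ℚ ≤ a → 0ℚ ≤ b → 0ℚ ≤ a * b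
*-nonNeg {a} {b} 0≤a 0≤b =
  subst (_≤ a * b) (ℚP.*-zeroʳ a) (ℚP.*-monoˡ-≤-nonNeg a {{nonNegative 0≤a}} 0≤b)

≤-+-nonNeg : ∀ a {b} → 0ℚ ≤ b → a ≤ a + b
≤-+-nonNeg a 0≤b = ℚP.≤-trans (ℚP.≤-reflexive (sym (ℚP.+-identityʳ a))) (ℚP.+-monoʳ-≤ a 0≤b)

*-monoˡ-≤-nonNeg′ : ∀ {a b c} → 0ℚ ≤ c → a ≤ b → c * a ≤ c * b
*-monoˡ-≤-nonNeg′ {c = c} 0≤c = ℚP.*-monoˡ-≤-nonNeg c {{nonNegative 0≤c}}

*-monoʳ-≤-nonNeg′ : ∀ {a b c} → 0ℚ ≤ c → a ≤ b → a * c ≤ b * c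
*-monoʳ-≤-nonNeg′ {c = c} 0≤c = ℚP.*-monoʳ-≤-nonNeg c {{nonNegative 0≤c}}

private
  variable
    A B : Set

∑ : List A → (A → ℚ) → ℚ
∑ xs f = sumℚ (L.map f xs)

syntax ∑ xs (λ x → e) = ∑[ x ∈ xs ] e

∑-cong : (xs : List A) {f g : A → ℚ} → (∀ x → f x ≡ g x) → ∑ xs f ≡ ∑ xs g
∑-cong [] f≗g = refl
∑-cong (x ∷ xs) f≗g = cong₂ _+_ (f≗g x) (∑-cong xs f≗g)

∑-+ : (xs : List A) (f g : A → ℚ) → ∑[ x ∈ xs ] (f x + g x) ≡ ∑ xs f + ∑ xs g
∑-+ [] f g = refl
∑-+ (x ∷ xs) f g = trans (cong (f x + g x +_) (∑-+ xs f g)) (swap (f x) (g x) (∑ xs f) (∑ xs g))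
  where
  swap : ∀ a b c d → a + b + (c + d) ≡ a + c + (b + d)
  swap = solve 4 (λ a b c d → a :+ b :+ (c :+ d) := a :+ c :+ (b :+ d)) refl

∑-*ˡ : (xs : List A) (c : ℚ) (f : A → ℚ) → ∑[ x ∈ xs ] (c * f x) ≡ c * ∑ xs f
∑-*ˡ [] c f = sym (ℚP.*-zeroʳ c)
∑-*ˡ (x ∷ xs) c f = trans (cong (c * f x +_) (∑-*ˡ xs c f)) (sym (ℚP.*-distribˡ-+ c (f x) (∑ xs f)))

∑-const : (xs : List A) (c : ℚ) → ∑[ x ∈ xs ] c ≡ ℕ→ℚ (L.length xs) * c
∑-const [] c = sym (ℚP.*-zeroˡ c)
∑-const (x ∷ xs) c = begin
  c + ∑[ x ∈ xs ] c                          ≡⟨ cong (c +_) (∑-const xs c) ⟩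
  c + ℕ→ℚ (L.length xs) * c                  ≡⟨ distrib c (ℕ→ℚ (L.length xs)) ⟩
  (1ℚ + ℕ→ℚ (L.length xs)) * c               ≡⟨ cong (_* c) (sym (ℕ→ℚ-+ 1 (L.length xs))) ⟩
  ℕ→ℚ (L.length (x ∷ xs)) * c                ∎
  where
  open ≡-Reasoning
  distrib : ∀ c k → c + k * c ≡ (1ℚ + k) * c
  distrib = solve 2 (λ c k → c :+ k :* c := (con 1ℚ :+ k) :* c) refl

∑-mono-≤ : {xs : List A} {f g : A → ℚ} → All (λ x → f x ≤ g x) xs → ∑ xs f ≤ ∑ xs g
∑-mono-≤ [] = ℚP.≤-refl
∑-mono-≤ (fx≤gx ∷ f≤g) = ℚP.+-mono-≤ fx≤gx (∑-mono-≤ f≤g)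

∑-zero : (xs : List A) → ∑[ x ∈ xs ] 0ℚ ≡ 0ℚ
∑-zero xs = trans (∑-const xs 0ℚ) (ℚP.*-zeroʳ (ℕ→ℚ (L.length xs)))

∑-nonNeg : {xs : List A} {f : A → ℚ} → All (λ x → 0ℚ ≤ f x) xs → 0ℚ ≤ ∑ xs f
∑-nonNeg {xs = xs} {f} 0≤f = subst (_≤ ∑ xs f) (∑-zero xs) (∑-mono-≤ {f = λ _ → 0ℚ} 0≤f)

∑-comm : (xs : List A) (ys : List B) (F : A → B → ℚ) →
  ∑[ x ∈ xs ] ∑[ y ∈ ys ] F x y ≡ ∑[ y ∈ ys ] ∑[ x ∈ xs ] F x y
∑-comm [] ys F = sym (∑-zero ys)
∑-comm (x ∷ xs) ys F =
  trans (cong (∑ ys (F x) +_) (∑-comm xs ys F)) (sym (∑-+ ys (F x) λ y → ∑[ x ∈ xs ] F x y))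

∑-map : (h : B → A) (xs : List B) (f : A → ℚ) → ∑ (L.map h xs) f ≡ ∑[ y ∈ xs ] f (h y)
∑-map h xs f = cong sumℚ (sym (map-∘ xs))

∑-++ : (xs ys : List A) (f : A → ℚ) → ∑ (xs ++ ys) f ≡ ∑ xs f + ∑ ys f
∑-++ [] ys f = sym (ℚP.+-identityˡ _)
∑-++ (x ∷ xs) ys f = trans (cong (f x +_) (∑-++ xs ys f)) (sym (ℚP.+-assoc (f x) _ _))

𝟙 : Bool → ℚ
𝟙 true = 1ℚ
𝟙 false = 0ℚ

𝟙-∧ : ∀ a b → 𝟙 (a ∧ b) ≡ 𝟙 a * 𝟙 b
𝟙-∧ true b = sym (ℚP.*-identityˡ (𝟙 b))
𝟙-∧ false b = sym (ℚP.*-zeroˡ (𝟙 b))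

𝟙-nonNeg : ∀ b → 0ℚ ≤ 𝟙 b
𝟙-nonNeg true = *≤* (ℤ.+≤+ ℕ.z≤n)
𝟙-nonNeg false = ℚP.≤-refl

χ : Bool → ℚ
χ false = 1ℚ
χ true = - 1ℚ

χ-xor : ∀ a b → χ (a xor b) ≡ χ a * χ b
χ-xor true true = refl
χ-xor true false = refl
χ-xor false true = refl
χ-xor false false = refl

𝟙-≡ᵇ : ∀ b r → 𝟙 (boolEq b r) ≡ ½ * (1ℚ + χ r * χ b)
𝟙-≡ᵇ true true = refl
𝟙-≡ᵇ true false = refl
𝟙-≡ᵇ false true = refl
𝟙-≡ᵇ false false = refl

∑-*ʳ : (xs : List A) (c : ℚ) (f : A → ℚ) → ∑[ x ∈ xs ] (f x * c) ≡ ∑ xs f * c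
∑-*ʳ xs c f = trans (∑-cong xs λ x → ℚP.*-comm (f x) c) (trans (∑-*ˡ xs c f) (ℚP.*-comm c (∑ xs f)))

∑-𝟙 : (p : A → Bool) (xs : List A) → ∑[ x ∈ xs ] 𝟙 (p x) ≡ ℕ→ℚ (L.length (L.filterᵇ p xs))
∑-𝟙 p [] = refl
∑-𝟙 p (x ∷ xs) with p x
... | true = trans (cong (1ℚ +_) (∑-𝟙 p xs)) (sym (ℕ→ℚ-+ 1 (L.length (L.filterᵇ p xs))))
... | false = trans (ℚP.+-identityˡ _) (∑-𝟙 p xs)

𝟙+𝟙-not : ∀ b → 𝟙 b + 𝟙 (not b) ≡ 1ℚ
𝟙+𝟙-not true = refl
𝟙+𝟙-not false = refl

-- Counting

distinct-choice : ∀ {xs : List A} h → Unique xs → h ℕ.< L.length xs →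
  Σ (Fin (suc h) → A) λ ι → Injective _≡_ _≡_ ι × (∀ j → ι j ∈ xs)
distinct-choice {xs = x ∷ xs} zero _ _ = (λ _ → x) , (λ { {Fin.zero} {Fin.zero} _ → refl }) , (λ _ → here refl)
distinct-choice {xs = x ∷ xs} (suc h) (x∉xs ∷ unique) (ℕ.s≤s h<len) with distinct-choice h unique h<len
... | ι , ι-injective , ι∈xs = (x VF.∷ ι) , injective , ∈x∷xs
  where
  injective : Injective _≡_ _≡_ (x VF.∷ ι)
  injective {Fin.zero} {Fin.zero} _ = refl
  injective {Fin.zero} {Fin.suc j} x≡ιj = ⊥-elim (All.lookup x∉xs (ι∈xs j) x≡ιj)
  injective {Fin.suc i} {Fin.zero} ιi≡x = ⊥-elim (All.lookup x∉xs (ι∈xs i) (sym ιi≡x))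
  injective {Fin.suc i} {Fin.suc j} ιi≡ιj = cong Fin.suc (ι-injective ιi≡ιj)
  ∈x∷xs : ∀ j → (x VF.∷ ι) j ∈ x ∷ xs
  ∈x∷xs Fin.zero = here refl
  ∈x∷xs (Fin.suc j) = there (ι∈xs j)

∑𝟙+∑𝟙-not : (p : A → Bool) (xs : List A) →
  ∑[ x ∈ xs ] 𝟙 (p x) + ∑[ x ∈ xs ] 𝟙 (not (p x)) ≡ ℕ→ℚ (L.length xs)
∑𝟙+∑𝟙-not p xs = begin
  ∑[ x ∈ xs ] 𝟙 (p x) + ∑[ x ∈ xs ] 𝟙 (not (p x))  ≡⟨ sym (∑-+ xs (𝟙 ∘ p) (𝟙 ∘ not ∘ p)) ⟩
  ∑[ x ∈ xs ] (𝟙 (p x) + 𝟙 (not (p x)))             ≡⟨ ∑-cong xs (𝟙+𝟙-not ∘ p) ⟩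
  ∑[ x ∈ xs ] 1ℚ                                   ≡⟨ ∑-const xs 1ℚ ⟩
  ℕ→ℚ (L.length xs) * 1ℚ                           ≡⟨ ℚP.*-identityʳ _ ⟩
  ℕ→ℚ (L.length xs)                                ∎
  where open ≡-Reasoning

failures≤h : ∀ {m} h (p : Fin m → Bool) →
  (∀ (ι : Fin (suc h) → Fin m) → Injective _≡_ _≡_ ι → ¬ (∀ j → p (ι j) ≡ false)) →
  L.length (L.filterᵇ (not ∘ p) (L.allFin m)) ℕ.≤ h
failures≤h {m} h p no-choice = ℕP.≮⇒≥ λ h<len →
  let ι , ι-injective , ι∈ = distinct-choice h (filter⁺ (T? ∘ not ∘ p) (allFin⁺ m)) h<len
  in no-choice ι ι-injective λ j →
       Equivalence.to T-not-≡ (proj₂ (∈-filter⁻ (T? ∘ not ∘ p) {xs = L.allFin m} (ι∈ j)))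

few-failures : ∀ {m} h (p : Fin m → Bool) →
  (∀ (ι : Fin (suc h) → Fin m) → Injective _≡_ _≡_ ι → ¬ (∀ j → p (ι j) ≡ false)) →
  ℕ→ℚ m - ℕ→ℚ h ≤ ∑[ i ∈ L.allFin m ] 𝟙 (p i)
few-failures {m} h p no-choice = begin
  ℕ→ℚ m - ℕ→ℚ h    ≡⟨ cong (_- ℕ→ℚ h) m≡G+F ⟩
  G + F - ℕ→ℚ h    ≤⟨ ℚP.+-monoˡ-≤ (- ℕ→ℚ h) (ℚP.+-monoʳ-≤ G F≤h) ⟩
  G + ℕ→ℚ h - ℕ→ℚ h ≡⟨ cancel G (ℕ→ℚ h) ⟩
  G                ∎
  where
  open ℚP.≤-Reasoning
  G = ∑[ i ∈ L.allFin m ] 𝟙 (p i)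
  F = ∑[ i ∈ L.allFin m ] 𝟙 (not (p i))
  m≡G+F : ℕ→ℚ m ≡ G + F
  m≡G+F = sym (trans (∑𝟙+∑𝟙-not p (L.allFin m)) (cong ℕ→ℚ (length-tabulate {n = m} (λ i → i))))
  F≤h : F ≤ ℕ→ℚ h
  F≤h = ℚP.≤-trans (ℚP.≤-reflexive (∑-𝟙 (not ∘ p) (L.allFin m))) (ℕ→ℚ-mono-≤ (failures≤h h p no-choice))
  cancel : ∀ g h → g + h + - h ≡ g
  cancel = solve 2 (λ g h → g :+ h :+ :- h := g) refl

∑-≥-all-but : ∀ {m} h (x : Fin m → ℚ) {a z} → (∀ i → 0ℚ ≤ x i) → 0ℚ ≤ z → z ≤ a →
  (∀ (ι : Fin (suc h) → Fin m) → Injective _≡_ _≡_ ι → ¬ (∀ j → ¬ x (ι j) ≡ a)) →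
  (ℕ→ℚ m - ℕ→ℚ h) * z ≤ ∑[ i ∈ L.allFin m ] x i
∑-≥-all-but {m} h x {a} {z} 0≤x 0≤z z≤a few-misses = begin
  (ℕ→ℚ m - ℕ→ℚ h) * z               ≤⟨ *-monoʳ-≤-nonNeg′ 0≤z (few-failures h hit no-choice) ⟩
  G * z                             ≤⟨ *-monoˡ-≤-nonNeg′ (∑-nonNeg (All.universal (𝟙-nonNeg ∘ hit) (L.allFin m))) z≤a ⟩
  G * a                             ≡⟨ sym (∑-*ʳ (L.allFin m) a (𝟙 ∘ hit)) ⟩
  ∑[ i ∈ L.allFin m ] (𝟙 (hit i) * a) ≤⟨ ∑-mono-≤ (All.universal termwise (L.allFin m)) ⟩
  ∑[ i ∈ L.allFin m ] x i           ∎
  where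
  open ℚP.≤-Reasoning
  hit : Fin m → Bool
  hit i = does (x i ℚP.≟ a)
  G = ∑[ i ∈ L.allFin m ] 𝟙 (hit i)
  termwise : ∀ i → 𝟙 (does (x i ℚP.≟ a)) * a ≤ x i
  termwise i with x i ℚP.≟ a
  ... | yes xi≡a = ℚP.≤-reflexive (trans (ℚP.*-identityˡ a) (sym xi≡a))
  ... | no _ = subst (_≤ x i) (sym (ℚP.*-zeroˡ a)) (0≤x i)
  no-choice : ∀ ι → Injective _≡_ _≡_ ι → ¬ (∀ j → hit (ι j) ≡ false)
  no-choice ι ι-injective all-miss = few-misses ι ι-injective λ j xιj≡a →
    case trans (sym (dec-true (x (ι j) ℚP.≟ a) xιj≡a)) (all-miss j) of λ ()

-- Characters and Fourier coefficients

length-allVecs : ∀ n → L.length (allVecs n) ≡ 2 ^ n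
length-allVecs zero = refl
length-allVecs (suc n) = begin
  L.length (L.map (false ∷_) (allVecs n) ++ L.map (true ∷_) (allVecs n))
    ≡⟨ length-++ (L.map (false ∷_) (allVecs n)) ⟩
  L.length (L.map (false ∷_) (allVecs n)) ℕ.+ L.length (L.map (true ∷_) (allVecs n))
    ≡⟨ cong₂ ℕ._+_ (length-map (false ∷_) (allVecs n)) (length-map (true ∷_) (allVecs n)) ⟩
  L.length (allVecs n) ℕ.+ L.length (allVecs n)
    ≡⟨ cong₂ ℕ._+_ (length-allVecs n) (trans (length-allVecs n) (sym (ℕP.+-identityʳ (2 ^ n)))) ⟩
  2 ^ suc n ∎
  where open ≡-Reasoning

∑-allVecs-suc : ∀ n (f : 𝔽₂^ (suc n) → ℚ) →
  ∑ (allVecs (suc n)) f ≡ ∑[ x ∈ allVecs n ] f (false ∷ x) + ∑[ x ∈ allVecs n ] f (true ∷ x)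
∑-allVecs-suc n f = trans (∑-++ (L.map (false ∷_) (allVecs n)) _ f)
                          (cong₂ _+_ (∑-map (false ∷_) (allVecs n) f) (∑-map (true ∷_) (allVecs n) f))

∑1-allVecs : ∀ n → ∑[ x ∈ allVecs n ] 1ℚ ≡ ℕ→ℚ (2 ^ n)
∑1-allVecs n = trans (∑-const (allVecs n) 1ℚ) (trans (ℚP.*-identityʳ _) (cong ℕ→ℚ (length-allVecs n)))

∑χ-allVecs-𝟎 : ∀ n → ∑[ x ∈ allVecs n ] χ ⟨ 𝟎 , x ⟩ ≡ ℕ→ℚ (2 ^ n)
∑χ-allVecs-𝟎 n = trans (∑-cong (allVecs n) λ x → cong χ (inner-𝟎ˡ x)) (∑1-allVecs n)

∑χ-allVecs-≢𝟎 : ∀ {n} (u : 𝔽₂^ n) → ¬ u ≡ 𝟎 → ∑[ x ∈ allVecs n ] χ ⟨ u , x ⟩ ≡ 0ℚ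
∑χ-allVecs-≢𝟎 [] u≢𝟎 = ⊥-elim (u≢𝟎 refl)
∑χ-allVecs-≢𝟎 {suc n} (false ∷ u) u≢𝟎 =
  trans (∑-allVecs-suc n _) (cong₂ _+_ sum≡0 sum≡0)
  where sum≡0 = ∑χ-allVecs-≢𝟎 u (u≢𝟎 ∘ cong (false ∷_))
∑χ-allVecs-≢𝟎 {suc n} (true ∷ u) _ = begin
  ∑[ x ∈ allVecs (suc n) ] χ ⟨ true ∷ u , x ⟩      ≡⟨ ∑-allVecs-suc n _ ⟩
  S + ∑[ x ∈ allVecs n ] χ (true xor ⟨ u , x ⟩)    ≡⟨ cong (S +_) (∑-cong (allVecs n) λ x → χ-xor true ⟨ u , x ⟩) ⟩
  S + ∑[ x ∈ allVecs n ] (- 1ℚ * χ ⟨ u , x ⟩)      ≡⟨ cong (S +_) (∑-*ˡ (allVecs n) (- 1ℚ) _) ⟩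
  S + - 1ℚ * S                                     ≡⟨ cancel S ⟩
  0ℚ                                               ∎
  where
  open ≡-Reasoning
  S = ∑[ x ∈ allVecs n ] χ ⟨ u , x ⟩
  cancel : ∀ s → s + - 1ℚ * s ≡ 0ℚ
  cancel = solve 1 (λ s → s :+ con (- 1ℚ) :* s := con 0ℚ) refl

-- Each point of the span occurs once per coefficient vector, so 2^k times in all.
members : ∀ {n} → Subspace n → List (𝔽₂^ n)
members (span k g) = L.map (λ c → lincomb (lookup c) g) (allVecs k)

∑χ-members-∈⊥ : ∀ {n k} (g : Fin k → 𝔽₂^ n) {ℓ} → ℓ ∈⊥ span k g →
  ∑[ y ∈ members (span k g) ] χ ⟨ ℓ , y ⟩ ≡ ℕ→ℚ (2 ^ k)
∑χ-members-∈⊥ {k = k} g ℓ⊥ =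
  trans (∑-map _ (allVecs k) _)
        (trans (∑-cong (allVecs k) λ c → cong χ (ℓ⊥ _ (lookup c , refl))) (∑1-allVecs k))

∑χ-members-∉⊥ : ∀ {n k} (g : Fin k → 𝔽₂^ n) {ℓ} → ¬ ℓ ∈⊥ span k g →
  ∑[ y ∈ members (span k g) ] χ ⟨ ℓ , y ⟩ ≡ 0ℚ
∑χ-members-∉⊥ {k = k} g {ℓ} ℓ⊥̸ =
  trans (∑-map _ (allVecs k) _)
        (trans (∑-cong (allVecs k) λ c → cong χ (inner-lincomb-lookup c))
               (∑χ-allVecs-≢𝟎 (onGenerators ℓ g) (ℓ⊥̸ ∘ onGenerators≡𝟎⇒∈⊥ ℓ g)))
  where
  inner-lincomb-lookup : ∀ c → ⟨ ℓ , lincomb (lookup c) g ⟩ ≡ ⟨ onGenerators ℓ g , c ⟩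
  inner-lincomb-lookup c = trans (inner-lincomb ℓ (lookup c) g) (cong ⟨ onGenerators ℓ g ,_⟩ (tabulate∘lookup c))

Path : ℕ → Set
Path n = List (𝔽₂^ n × Bool)

_⊨_ : ∀ {n} → 𝔽₂^ n → Path n → Bool
x ⊨ [] = true
x ⊨ ((ℓ , r) ∷ π) = boolEq ⟨ ℓ , x ⟩ r ∧ x ⊨ π

fourierCoefficient : ∀ {n} → List (𝔽₂^ n) → Path n → 𝔽₂^ n → ℚ
fourierCoefficient L π ℓ₀ = ∑[ y ∈ L ] (𝟙 (y ⊨ π) * χ ⟨ ℓ₀ , y ⟩)

fourierCoefficient-[] : ∀ {n} (L : List (𝔽₂^ n)) ℓ₀ → fourierCoefficient L [] ℓ₀ ≡ ∑[ y ∈ L ] χ ⟨ ℓ₀ , y ⟩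
fourierCoefficient-[] L ℓ₀ = ∑-cong L λ y → ℚP.*-identityˡ (χ ⟨ ℓ₀ , y ⟩)

-- Expanding 𝟙[⟨ ℓ , y ⟩ = r] = (1 + χ r χ ⟨ ℓ , y ⟩) / 2.
fourierCoefficient-∷ : ∀ {n} (L : List (𝔽₂^ n)) ℓ r π ℓ₀ →
  fourierCoefficient L ((ℓ , r) ∷ π) ℓ₀ ≡
  ½ * (fourierCoefficient L π ℓ₀ + χ r * fourierCoefficient L π (ℓ₀ ⊕ ℓ))
fourierCoefficient-∷ L ℓ r π ℓ₀ =
  trans (∑-cong L summand)
        (trans (∑-*ˡ L ½ λ y → f₀ y + χ r * f₁ y)
               (cong (½ *_) (trans (∑-+ L f₀ λ y → χ r * f₁ y) (cong (∑ L f₀ +_) (∑-*ˡ L (χ r) f₁)))))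
  where
  open ≡-Reasoning
  f₀ f₁ : 𝔽₂^ _ → ℚ
  f₀ y = 𝟙 (y ⊨ π) * χ ⟨ ℓ₀ , y ⟩
  f₁ y = 𝟙 (y ⊨ π) * χ ⟨ ℓ₀ ⊕ ℓ , y ⟩
  expand : ∀ a b c r → ½ * (1ℚ + r * b) * a * c ≡ ½ * (a * c + r * (a * (c * b)))
  expand = solve 4 (λ a b c r → con ½ :* (con 1ℚ :+ r :* b) :* a :* c := con ½ :* (a :* c :+ r :* (a :* (c :* b)))) refl
  summand : ∀ y → 𝟙 (y ⊨ ((ℓ , r) ∷ π)) * χ ⟨ ℓ₀ , y ⟩ ≡
                  ½ * (𝟙 (y ⊨ π) * χ ⟨ ℓ₀ , y ⟩ + χ r * (𝟙 (y ⊨ π) * χ ⟨ ℓ₀ ⊕ ℓ , y ⟩))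
  summand y = begin
    𝟙 (boolEq ⟨ ℓ , y ⟩ r ∧ y ⊨ π) * χ ⟨ ℓ₀ , y ⟩
      ≡⟨ cong (_* χ ⟨ ℓ₀ , y ⟩) (trans (𝟙-∧ (boolEq ⟨ ℓ , y ⟩ r) (y ⊨ π))
                                       (cong (_* 𝟙 (y ⊨ π)) (𝟙-≡ᵇ ⟨ ℓ , y ⟩ r))) ⟩
    ½ * (1ℚ + χ r * χ ⟨ ℓ , y ⟩) * 𝟙 (y ⊨ π) * χ ⟨ ℓ₀ , y ⟩
      ≡⟨ expand (𝟙 (y ⊨ π)) (χ ⟨ ℓ , y ⟩) (χ ⟨ ℓ₀ , y ⟩) (χ r) ⟩
    ½ * (𝟙 (y ⊨ π) * χ ⟨ ℓ₀ , y ⟩ + χ r * (𝟙 (y ⊨ π) * (χ ⟨ ℓ₀ , y ⟩ * χ ⟨ ℓ , y ⟩)))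
      ≡⟨ cong (λ e → ½ * (𝟙 (y ⊨ π) * χ ⟨ ℓ₀ , y ⟩ + χ r * (𝟙 (y ⊨ π) * e)))
              (sym (χ-inner-⊕ˡ ℓ₀ ℓ y)) ⟩
    ½ * (𝟙 (y ⊨ π) * χ ⟨ ℓ₀ , y ⟩ + χ r * (𝟙 (y ⊨ π) * χ ⟨ ℓ₀ ⊕ ℓ , y ⟩)) ∎
    where
    χ-inner-⊕ˡ : ∀ a b y → χ ⟨ a ⊕ b , y ⟩ ≡ χ ⟨ a , y ⟩ * χ ⟨ b , y ⟩
    χ-inner-⊕ˡ a b y = trans (cong χ (inner-⊕ˡ a b y)) (χ-xor ⟨ a , y ⟩ ⟨ b , y ⟩)

∑χ-allVecs-vs-members : ∀ {n k} (g : Fin k → 𝔽₂^ n) ℓ₀ → (ℓ₀ ∈⊥ span k g → ℓ₀ ≡ 𝟎) →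
  ℕ→ℚ (2 ^ k) * ∑[ x ∈ allVecs n ] χ ⟨ ℓ₀ , x ⟩ ≡
  ℕ→ℚ (2 ^ n) * ∑[ y ∈ members (span k g) ] χ ⟨ ℓ₀ , y ⟩
∑χ-allVecs-vs-members {n} {k} g ℓ₀ ⊥⇒𝟎 with ≡-dec _≟_ ℓ₀ 𝟎
... | yes refl = begin
  K * ∑[ x ∈ allVecs n ] χ ⟨ 𝟎 , x ⟩              ≡⟨ cong (K *_) (∑χ-allVecs-𝟎 n) ⟩
  K * N                                           ≡⟨ ℚP.*-comm K N ⟩
  N * K                                           ≡⟨ cong (N *_) (sym (∑χ-members-∈⊥ g {𝟎} λ y _ → inner-𝟎ˡ y)) ⟩
  N * ∑[ y ∈ members (span k g) ] χ ⟨ 𝟎 , y ⟩    ∎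
  where
  open ≡-Reasoning
  K = ℕ→ℚ (2 ^ k)
  N = ℕ→ℚ (2 ^ n)
... | no ℓ₀≢𝟎 = begin
  K * ∑[ x ∈ allVecs n ] χ ⟨ ℓ₀ , x ⟩              ≡⟨ cong (K *_) (∑χ-allVecs-≢𝟎 ℓ₀ ℓ₀≢𝟎) ⟩
  K * 0ℚ                                          ≡⟨ ℚP.*-zeroʳ K ⟩
  0ℚ                                              ≡⟨ sym (ℚP.*-zeroʳ N) ⟩
  N * 0ℚ                                          ≡⟨ cong (N *_) (sym (∑χ-members-∉⊥ g {ℓ₀} (ℓ₀≢𝟎 ∘ ⊥⇒𝟎))) ⟩
  N * ∑[ y ∈ members (span k g) ] χ ⟨ ℓ₀ , y ⟩   ∎
  where
  open ≡-Reasoning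
  K = ℕ→ℚ (2 ^ k)
  N = ℕ→ℚ (2 ^ n)

fourierCoefficient-members : ∀ {n k} (g : Fin k → 𝔽₂^ n) π ℓ₀ → Avoids (span k g) ℓ₀ (L.map proj₁ π) →
  ℕ→ℚ (2 ^ k) * fourierCoefficient (allVecs n) π ℓ₀ ≡
  ℕ→ℚ (2 ^ n) * fourierCoefficient (members (span k g)) π ℓ₀
fourierCoefficient-members {n} {k} g [] ℓ₀ avoids
  rewrite fourierCoefficient-[] (allVecs n) ℓ₀ | fourierCoefficient-[] (members (span k g)) ℓ₀ =
  ∑χ-allVecs-vs-members g ℓ₀ (avoids base)
fourierCoefficient-members {n} {k} g ((ℓ , r) ∷ π) ℓ₀ avoids = begin
  K * F (allVecs n) ((ℓ , r) ∷ π) ℓ₀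
    ≡⟨ cong (K *_) (fourierCoefficient-∷ (allVecs n) ℓ r π ℓ₀) ⟩
  K * (½ * (F (allVecs n) π ℓ₀ + χ r * F (allVecs n) π (ℓ₀ ⊕ ℓ)))
    ≡⟨ distribute K _ _ (χ r) ⟩
  ½ * (K * F (allVecs n) π ℓ₀ + χ r * (K * F (allVecs n) π (ℓ₀ ⊕ ℓ)))
    ≡⟨ cong₂ (λ a b → ½ * (a + χ r * b))
             (fourierCoefficient-members g π ℓ₀ (avoids ∘ skip))
             (fourierCoefficient-members g π (ℓ₀ ⊕ ℓ) (avoids ∘ add)) ⟩
  ½ * (N * F V π ℓ₀ + χ r * (N * F V π (ℓ₀ ⊕ ℓ)))
    ≡⟨ sym (distribute N _ _ (χ r)) ⟩
  N * (½ * (F V π ℓ₀ + χ r * F V π (ℓ₀ ⊕ ℓ)))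
    ≡⟨ cong (N *_) (sym (fourierCoefficient-∷ V ℓ r π ℓ₀)) ⟩
  N * F V ((ℓ , r) ∷ π) ℓ₀ ∎
  where
  open ≡-Reasoning
  F = fourierCoefficient
  K = ℕ→ℚ (2 ^ k)
  N = ℕ→ℚ (2 ^ n)
  V = members (span k g)
  distribute : ∀ c a b r → c * (½ * (a + r * b)) ≡ ½ * (c * a + r * (c * b))
  distribute = solve 4 (λ c a b r → c :* (con ½ :* (a :+ r :* b)) := con ½ :* (c :* a :+ r :* (c :* b))) refl

mass : ∀ {n} → List (𝔽₂^ n) → Path n → (𝔽₂^ n → Bool) → ℚ
mass L π q = ∑[ x ∈ L ] 𝟙 (x ⊨ π ∧ q x)

fourierCoefficient-𝟎 : ∀ {n} (L : List (𝔽₂^ n)) π → fourierCoefficient L π 𝟎 ≡ mass L π (λ _ → true)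
fourierCoefficient-𝟎 L π = ∑-cong L λ y → trans (cong (λ b → 𝟙 (y ⊨ π) * χ b) (inner-𝟎ˡ y)) (𝟙-*1 (y ⊨ π))
  where
  𝟙-*1 : ∀ a → 𝟙 a * 1ℚ ≡ 𝟙 (a ∧ true)
  𝟙-*1 true = refl
  𝟙-*1 false = refl

2^-pos : ∀ k → 0ℚ < ℕ→ℚ (2 ^ k)
2^-pos k = ℚP.<-≤-trans (*<* (ℤ.+<+ (ℕ.s≤s ℕ.z≤n))) (ℕ→ℚ-mono-≤ (ℕP.m^n>0 2 k))

weight : ∀ {n} → Subspace n → ℚ
weight {n} (span k g) = ℕ→ℚ (2 ^ n) * (1/ ℕ→ℚ (2 ^ k)) {{>-nonZero (2^-pos k)}}

weight-*-2^k : ∀ {n} (V : Subspace n) → weight V * ℕ→ℚ (2 ^ Subspace.k V) ≡ ℕ→ℚ (2 ^ n)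
weight-*-2^k {n} (span k g) =
  trans (ℚP.*-assoc N (1/ K) K) (trans (cong (N *_) (ℚP.*-inverseˡ K)) (ℚP.*-identityʳ N))
  where
  N = ℕ→ℚ (2 ^ n)
  K = ℕ→ℚ (2 ^ k)
  instance _ = >-nonZero (2^-pos k)

weight-nonNeg : ∀ {n} (V : Subspace n) → 0ℚ ≤ weight V
weight-nonNeg {n} (span k g) = *-nonNeg (ℕ→ℚ-nonNeg (2 ^ n)) (ℚP.<⇒≤ (ℚP.positive⁻¹ (1/ K)))
  where
  K = ℕ→ℚ (2 ^ k)
  instance
    _ = >-nonZero (2^-pos k)
    _ = positive (2^-pos k)
    _ = ℚP.1/pos⇒pos K

-- The points of V are equidistributed over the cells of any path that V^⊥ avoids.
weight-mass-members : ∀ {n} (V : Subspace n) π → Avoids V 𝟎 (L.map proj₁ π) →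
  weight V * mass (members V) π (λ _ → true) ≡ mass (allVecs n) π (λ _ → true)
weight-mass-members {n} (span k g) π avoids = begin
  N * (1/ K) * mass V π (λ _ → true)     ≡⟨ reassoc N (1/ K) _ ⟩
  1/ K * (N * mass V π (λ _ → true))     ≡⟨ cong (λ c → 1/ K * (N * c)) (sym (fourierCoefficient-𝟎 V π)) ⟩
  1/ K * (N * fourierCoefficient V π 𝟎)   ≡⟨ cong (1/ K *_) (sym (fourierCoefficient-members g π 𝟎 avoids)) ⟩
  1/ K * (K * fourierCoefficient U π 𝟎)   ≡⟨ sym (ℚP.*-assoc (1/ K) K _) ⟩
  1/ K * K * fourierCoefficient U π 𝟎     ≡⟨ cong (_* _) (ℚP.*-inverseˡ K) ⟩
  1ℚ * fourierCoefficient U π 𝟎           ≡⟨ ℚP.*-identityˡ _ ⟩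
  fourierCoefficient U π 𝟎                ≡⟨ fourierCoefficient-𝟎 U π ⟩
  mass U π (λ _ → true)                  ∎
  where
  open ≡-Reasoning
  N = ℕ→ℚ (2 ^ n)
  K = ℕ→ℚ (2 ^ k)
  instance _ = >-nonZero (2^-pos k)
  U = allVecs n
  V = members (span k g)
  reassoc : ∀ a b c → a * b * c ≡ b * (a * c)
  reassoc = solve 3 (λ a b c → a :* b :* c := b :* (a :* c)) refl

mass-nonNeg : ∀ {n} (L : List (𝔽₂^ n)) π q → 0ℚ ≤ mass L π q
mass-nonNeg L π q = ∑-nonNeg (All.universal (λ x → 𝟙-nonNeg (x ⊨ π ∧ q x)) L)

mass-≤-true : ∀ {n} (L : List (𝔽₂^ n)) π q → mass L π q ≤ mass L π (λ _ → true)
mass-≤-true L π q = ∑-mono-≤ (All.universal (λ x → 𝟙-∧-≤ (x ⊨ π) (q x)) L)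
  where
  𝟙-∧-≤ : ∀ a b → 𝟙 (a ∧ b) ≤ 𝟙 (a ∧ true)
  𝟙-∧-≤ true true = ℚP.≤-refl
  𝟙-∧-≤ true false = 𝟙-nonNeg true
  𝟙-∧-≤ false b = ℚP.≤-refl

mass-false : ∀ {n} (L : List (𝔽₂^ n)) π (q : 𝔽₂^ n → Bool) → mass L π (λ x → q x ∧ false) ≡ 0ℚ
mass-false L π q =
  trans (∑-cong L λ x → cong 𝟙 (trans (cong (x ⊨ π ∧_) (∧-zeroʳ (q x))) (∧-zeroʳ (x ⊨ π)))) (∑-zero L)

mass-split : ∀ {n} (L : List (𝔽₂^ n)) π ℓ (Q : 𝔽₂^ n → Bool → Bool) (a b : 𝔽₂^ n → Bool) →
  mass L π (λ x → Q x (if ⟨ ℓ , x ⟩ then a x else b x)) ≡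
  mass L ((ℓ , false) ∷ π) (λ x → Q x (b x)) + mass L ((ℓ , true) ∷ π) (λ x → Q x (a x))
mass-split L π ℓ Q a b =
  trans (∑-cong L λ x → split ⟨ ℓ , x ⟩ (x ⊨ π) (Q x) (a x) (b x))
        (∑-+ L (λ x → 𝟙 (x ⊨ ((ℓ , false) ∷ π) ∧ Q x (b x)))
               (λ x → 𝟙 (x ⊨ ((ℓ , true) ∷ π) ∧ Q x (a x))))
  where
  split : ∀ c p (Q : Bool → Bool) α β →
    𝟙 (p ∧ Q (if c then α else β)) ≡ 𝟙 ((boolEq c false ∧ p) ∧ Q β) + 𝟙 ((boolEq c true ∧ p) ∧ Q α)
  split true p Q α β = sym (ℚP.+-identityˡ _)
  split false p Q α β = sym (ℚP.+-identityʳ _)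

-- Randomised decision trees

𝔼 : List (ℚ × A) → (A → ℚ) → ℚ
𝔼 D g = ∑[ p ∈ D ] (proj₁ p * g (proj₂ p))

𝔼-mono-≤ : {D : List (ℚ × A)} {g g′ : A → ℚ} → All (λ p → 0ℚ ≤ proj₁ p) D →
  All (λ p → g (proj₂ p) ≤ g′ (proj₂ p)) D → 𝔼 D g ≤ 𝔼 D g′
𝔼-mono-≤ 0≤w g≤g′ = ∑-mono-≤ (All.zipWith (λ (0≤wp , le) → *-monoˡ-≤-nonNeg′ 0≤wp le) (0≤w , g≤g′))

𝔼-nonNeg : {D : List (ℚ × A)} {g : A → ℚ} → All (λ p → 0ℚ ≤ proj₁ p) D → (∀ a → 0ℚ ≤ g a) →
  0ℚ ≤ 𝔼 D g
𝔼-nonNeg 0≤w 0≤g = ∑-nonNeg (All.map (λ 0≤wp → *-nonNeg 0≤wp (0≤g _)) 0≤w)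

𝔼-const : (D : List (ℚ × A)) → sumℚ (L.map proj₁ D) ≡ 1ℚ → ∀ c → 𝔼 D (λ _ → c) ≡ c
𝔼-const D Σw≡1 c = trans (∑-*ʳ D c proj₁) (trans (cong (_* c) Σw≡1) (ℚP.*-identityˡ c))

𝔼-+ : (D : List (ℚ × A)) (g g′ : A → ℚ) → 𝔼 D (λ a → g a + g′ a) ≡ 𝔼 D g + 𝔼 D g′
𝔼-+ D g g′ = trans (∑-cong D λ p → ℚP.*-distribˡ-+ (proj₁ p) (g (proj₂ p)) (g′ (proj₂ p)))
                   (∑-+ D (λ p → proj₁ p * g (proj₂ p)) (λ p → proj₁ p * g′ (proj₂ p)))

𝔼-*ˡ : (D : List (ℚ × A)) (c : ℚ) (g : A → ℚ) → 𝔼 D (λ a → c * g a) ≡ c * 𝔼 D g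
𝔼-*ˡ D c g = trans (∑-cong D λ p → swap (proj₁ p) c (g (proj₂ p))) (∑-*ˡ D c λ p → proj₁ p * g (proj₂ p))
  where
  swap : ∀ w c x → w * (c * x) ≡ c * (w * x)
  swap = solve 3 (λ w c x → w :* (c :* x) := c :* (w :* x)) refl

𝔼-∑ : (D : List (ℚ × A)) (xs : List B) (F : B → A → ℚ) →
  𝔼 D (λ a → ∑[ x ∈ xs ] F x a) ≡ ∑[ x ∈ xs ] 𝔼 D (F x)
𝔼-∑ D xs F = trans (∑-cong D λ p → sym (∑-*ˡ xs (proj₁ p) λ x → F x (proj₂ p)))
                   (∑-comm D xs λ p x → proj₁ p * F x (proj₂ p))

errorProb : ∀ {n} → RPDT n → 𝔽₂^ n → Bool → ℚ
errorProb D x b = 𝔼 D (λ T → 𝟙 (not (boolEq (eval T x) b)))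

successProb+errorProb : ∀ {n} (D : RPDT n) → IsDistribution D → ∀ x b →
  successProb D x b + errorProb D x b ≡ 1ℚ
successProb+errorProb D (_ , Σw≡1) x b = begin
  successProb D x b + errorProb D x b
    ≡⟨ cong (_+ errorProb D x b) (∑-cong D λ p → if-as-𝟙 (agrees (proj₂ p)) (proj₁ p)) ⟩
  𝔼 D (𝟙 ∘ agrees) + 𝔼 D (𝟙 ∘ not ∘ agrees)
    ≡⟨ sym (𝔼-+ D (𝟙 ∘ agrees) (𝟙 ∘ not ∘ agrees)) ⟩
  𝔼 D (λ T → 𝟙 (agrees T) + 𝟙 (not (agrees T)))
    ≡⟨ ∑-cong D (λ p → cong (proj₁ p *_) (𝟙+𝟙-not (agrees (proj₂ p)))) ⟩
  𝔼 D (λ _ → 1ℚ)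
    ≡⟨ 𝔼-const D Σw≡1 1ℚ ⟩
  1ℚ ∎
  where
  open ≡-Reasoning
  agrees : PDT _ → Bool
  agrees T = boolEq (eval T x) b
  if-as-𝟙 : ∀ c w → (if c then w else 0ℚ) ≡ w * 𝟙 c
  if-as-𝟙 true w = sym (ℚP.*-identityʳ w)
  if-as-𝟙 false w = sym (ℚP.*-zeroʳ w)

errorProb≤ε : ∀ {n f ε} (D : RPDT n) → IsDistribution D → ComputesWithError f ε D → ∀ x →
  errorProb D x (f x) ≤ ε
errorProb≤ε {f = f} {ε} D dist computes x = begin
  E                  ≡⟨ isolate S E ⟩
  (S + E) - S        ≡⟨ cong (_- S) (successProb+errorProb D dist x (f x)) ⟩
  1ℚ - S             ≤⟨ ℚP.+-monoʳ-≤ 1ℚ (ℚP.neg-antimono-≤ (computes x)) ⟩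
  1ℚ - (1ℚ - ε)      ≡⟨ cancel ε ⟩
  ε                  ∎
  where
  open ℚP.≤-Reasoning
  S = successProb D x (f x)
  E = errorProb D x (f x)
  isolate : ∀ s e → e ≡ s + e + - s
  isolate = solve 2 (λ s e → e := s :+ e :+ :- s) refl
  cancel : ∀ e → 1ℚ + - (1ℚ + - e) ≡ e
  cancel = solve 1 (λ e → con 1ℚ :+ :- (con 1ℚ :+ :- e) := e) refl

computesWithError⇒0≤ε : ∀ {n f ε} (D : RPDT n) → IsDistribution D → ComputesWithError f ε D → 0ℚ ≤ ε
computesWithError⇒0≤ε {f = f} D dist computes =
  ℚP.≤-trans (𝔼-nonNeg (proj₁ dist) λ T → 𝟙-nonNeg (not (boolEq (eval T 𝟎) (f 𝟎))))
             (errorProb≤ε D dist computes 𝟎)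

≤-8·m·p·ε : ∀ m p {z ε} → 0ℚ ≤ ε → z ≤ ℕ→ℚ p →
  ℕ→ℚ m * (z * ε) + ℕ→ℚ m * (ℕ→ℚ p * ε) ≤ ε * (ℕ→ℚ (8 ℕ.* m) * ℕ→ℚ p)
≤-8·m·p·ε m p {z} {ε} 0≤ε z≤p = begin
  M * (z * ε) + X        ≤⟨ ℚP.+-monoˡ-≤ X (*-monoˡ-≤-nonNeg′ (ℕ→ℚ-nonNeg m) (*-monoʳ-≤-nonNeg′ 0≤ε z≤p)) ⟩
  X + X                  ≤⟨ ≤-+-nonNeg (X + X) (*-nonNeg (ℕ→ℚ-nonNeg 6) 0≤X) ⟩
  X + X + ℕ→ℚ 6 * X      ≡⟨ regroup M (ℕ→ℚ p) ε ⟩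
  ε * (ℕ→ℚ 8 * M * ℕ→ℚ p) ≡⟨ cong (λ e → ε * (e * ℕ→ℚ p)) (sym (ℕ→ℚ-* 8 m)) ⟩
  ε * (ℕ→ℚ (8 ℕ.* m) * ℕ→ℚ p) ∎
  where
  open ℚP.≤-Reasoning
  M = ℕ→ℚ m
  X = M * (ℕ→ℚ p * ε)
  0≤X : 0ℚ ≤ X
  0≤X = *-nonNeg (ℕ→ℚ-nonNeg m) (*-nonNeg (ℕ→ℚ-nonNeg p) 0≤ε)
  regroup : ∀ M P e → M * (P * e) + M * (P * e) + ℕ→ℚ 6 * (M * (P * e)) ≡ e * (ℕ→ℚ 8 * M * P)
  regroup = solve 3 (λ M P e → M :* (P :* e) :+ M :* (P :* e) :+ con (ℕ→ℚ 6) :* (M :* (P :* e))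
                             := e :* (con (ℕ→ℚ 8) :* M :* P)) refl

-- The hard input distribution

module HardDistribution {n m : ℕ} (V : Fin m → Subspace n) (f : 𝔽₂^ n → Bool) where

  falseAt : 𝔽₂^ n → Bool
  falseAt x = boolEq (f x) false

  -- The μ-mass of the inputs in the cell of π on which T errs, where μ weighs every zero of f
  -- by m and every listed point of V i by weight (V i).
  loss : Path n → PDT n → ℚ
  loss π T = ℕ→ℚ m * mass (allVecs n) π (λ x → falseAt x ∧ eval T x)
           + ∑[ i ∈ L.allFin m ] (weight (V i) * mass (members (V i)) π (λ y → not (eval T y)))

  loss-node : ∀ π ℓ l r → loss π (node ℓ l r) ≡ loss ((ℓ , false) ∷ π) l + loss ((ℓ , true) ∷ π) r
  loss-node π ℓ l r = trans (cong₂ (λ z o → ℕ→ℚ m * z + o) zeros-split ones-split)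
                            (regroup (ℕ→ℚ m) _ _ _ _)
    where
    πl = (ℓ , false) ∷ π
    πr = (ℓ , true) ∷ π
    ones : Path n → PDT n → Fin m → ℚ
    ones π T i = weight (V i) * mass (members (V i)) π (λ y → not (eval T y))
    zeros-split = mass-split (allVecs n) π ℓ (λ x o → falseAt x ∧ o) (eval r) (eval l)
    ones-split : ∑[ i ∈ L.allFin m ] ones π (node ℓ l r) i ≡
                 ∑[ i ∈ L.allFin m ] ones πl l i + ∑[ i ∈ L.allFin m ] ones πr r i
    ones-split = trans (∑-cong (L.allFin m) λ i →
                         trans (cong (weight (V i) *_) (mass-split (members (V i)) π ℓ (λ _ o → not o) (eval r) (eval l)))
                               (ℚP.*-distribˡ-+ (weight (V i)) _ _))
                       (∑-+ (L.allFin m) (ones πl l) (ones πr r))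
    regroup : ∀ c a b x y → c * (a + b) + (x + y) ≡ (c * a + x) + (c * b + y)
    regroup = solve 5 (λ c a b x y → c :* (a :+ b) :+ (x :+ y) := (c :* a :+ x) :+ (c :* b :+ y)) refl

  module _ {s h : ℕ} (design : IsDualSubspaceDesign s h V) where

    -- Whether V i^⊥ avoids the queried parities is not decidable here, so the indices are sorted
    -- by the decidable equation μ(cell ∩ V i) = |cell| and the design property is used under ¬¬.
    cell-bound : ∀ π → L.length π ℕ.≤ s →
      (ℕ→ℚ m - ℕ→ℚ h) * mass (allVecs n) π falseAt ≤
      ∑[ i ∈ L.allFin m ] (weight (V i) * mass (members (V i)) π (λ _ → true))
    cell-bound π len≤s =
      ∑-≥-all-but h (λ i → weight (V i) * mass (members (V i)) π (λ _ → true))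
        (λ i → *-nonNeg (weight-nonNeg (V i)) (mass-nonNeg (members (V i)) π (λ _ → true)))
        (mass-nonNeg (allVecs n) π falseAt) (mass-≤-true (allVecs n) π falseAt)
        λ ι ι-injective all-miss →
          ¬¬-∀ (λ j → ¬Avoids⇒¬¬Meets s (V (ι j)) len≤s′ λ avoids →
                        all-miss j (weight-mass-members (V (ι j)) π avoids))
               (design (pad s (L.map proj₁ π)) ι ι-injective)
      where
      len≤s′ : L.length (L.map proj₁ π) ℕ.≤ s
      len≤s′ = subst (ℕ._≤ s) (sym (length-map proj₁ π)) len≤s

    loss-bound : ∀ T π → L.length π ℕ.+ height T ℕ.≤ s →
      (ℕ→ℚ m - ℕ→ℚ h) * mass (allVecs n) π falseAt ≤ loss π T
    loss-bound (leaf true) π _ = begin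
      (ℕ→ℚ m - ℕ→ℚ h) * Z
        ≤⟨ *-monoʳ-≤-nonNeg′ (mass-nonNeg (allVecs n) π falseAt) m-h≤m ⟩
      ℕ→ℚ m * Z
        ≡⟨ cong (ℕ→ℚ m *_) (∑-cong (allVecs n) λ x → cong (λ b → 𝟙 (x ⊨ π ∧ b)) (sym (∧-identityʳ (falseAt x)))) ⟩
      ℕ→ℚ m * mass (allVecs n) π (λ x → falseAt x ∧ true)
        ≤⟨ ≤-+-nonNeg _ (∑-nonNeg (All.universal ones-nonNeg (L.allFin m))) ⟩
      loss π (leaf true) ∎
      where
      open ℚP.≤-Reasoning
      Z = mass (allVecs n) π falseAt
      m-h≤m : ℕ→ℚ m - ℕ→ℚ h ≤ ℕ→ℚ m
      m-h≤m = ℚP.≤-trans (ℚP.+-monoʳ-≤ (ℕ→ℚ m) (ℚP.neg-antimono-≤ (ℕ→ℚ-nonNeg h)))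
                         (ℚP.≤-reflexive (ℚP.+-identityʳ (ℕ→ℚ m)))
      ones-nonNeg : ∀ i → 0ℚ ≤ weight (V i) * mass (members (V i)) π (λ _ → false)
      ones-nonNeg i = *-nonNeg (weight-nonNeg (V i)) (mass-nonNeg (members (V i)) π (λ _ → false))
    loss-bound (leaf false) π budget = begin
      (ℕ→ℚ m - ℕ→ℚ h) * mass (allVecs n) π falseAt
        ≤⟨ cell-bound π (subst (ℕ._≤ s) (ℕP.+-identityʳ _) budget) ⟩
      S
        ≡⟨ sym (ℚP.+-identityˡ S) ⟩
      0ℚ + S
        ≡⟨ cong (_+ S) (sym (trans (cong (ℕ→ℚ m *_) (mass-false (allVecs n) π falseAt)) (ℚP.*-zeroʳ (ℕ→ℚ m)))) ⟩
      loss π (leaf false) ∎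
      where
      open ℚP.≤-Reasoning
      S = ∑[ i ∈ L.allFin m ] (weight (V i) * mass (members (V i)) π (λ _ → true))
    loss-bound (node ℓ l r) π budget = begin
      c * Z π
        ≡⟨ cong (c *_) (mass-split (allVecs n) π ℓ (λ x _ → falseAt x) (λ _ → true) (λ _ → true)) ⟩
      c * (Z πl + Z πr)
        ≡⟨ ℚP.*-distribˡ-+ c (Z πl) (Z πr) ⟩
      c * Z πl + c * Z πr
        ≤⟨ ℚP.+-mono-≤ (loss-bound l πl (child-budget (ℕP.m≤m⊔n (height l) (height r))))
                       (loss-bound r πr (child-budget (ℕP.m≤n⊔m (height l) (height r)))) ⟩
      loss πl l + loss πr r
        ≡⟨ sym (loss-node π ℓ l r) ⟩
      loss π (node ℓ l r) ∎
      where
      open ℚP.≤-Reasoning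
      c = ℕ→ℚ m - ℕ→ℚ h
      Z : Path n → ℚ
      Z π = mass (allVecs n) π falseAt
      πl = (ℓ , false) ∷ π
      πr = (ℓ , true) ∷ π
      child-budget : ∀ {a} → a ℕ.≤ height l ℕ.⊔ height r → suc (L.length π ℕ.+ a) ℕ.≤ s
      child-budget {a} a≤ = ℕP.≤-trans (ℕP.≤-reflexive (sym (ℕP.+-suc (L.length π) a)))
                                       (ℕP.≤-trans (ℕP.+-monoʳ-≤ (L.length π) (ℕ.s≤s a≤)) budget)

  module _ (D : RPDT n) (dist : IsDistribution D) where

    expectedLoss-lower : ∀ {s h} → IsDualSubspaceDesign s h V → CostBelow s D →
      (ℕ→ℚ m - ℕ→ℚ h) * mass (allVecs n) [] falseAt ≤ 𝔼 D (loss [])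
    expectedLoss-lower {s} {h} design cost = begin
      c                ≡⟨ sym (𝔼-const D (proj₂ dist) c) ⟩
      𝔼 D (λ _ → c)    ≤⟨ 𝔼-mono-≤ (proj₁ dist)
                             (All.map (λ {p} height<s → loss-bound design (proj₂ p) [] (ℕP.<⇒≤ height<s)) cost) ⟩
      𝔼 D (loss [])    ∎
      where
      open ℚP.≤-Reasoning
      c = (ℕ→ℚ m - ℕ→ℚ h) * mass (allVecs n) [] falseAt

  module _ (D : RPDT n) (dist : IsDistribution D) (hf : ∀ x → (f x ≡ true) ⇔ (∃ λ i → x ∈S V i))
           {ε : ℚ} (computes : ComputesWithError f ε D) where

    errorProb-at≤ε : ∀ x b → f x ≡ b → errorProb D x b ≤ ε
    errorProb-at≤ε x .(f x) refl = errorProb≤ε D dist computes x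

    zero-error : ∀ x → 𝔼 D (λ T → 𝟙 (falseAt x ∧ eval T x)) ≤ 𝟙 (falseAt x) * ε
    zero-error x = bound (f x) refl
      where
      bound : ∀ b → f x ≡ b → 𝔼 D (λ T → 𝟙 (boolEq b false ∧ eval T x)) ≤ 𝟙 (boolEq b false) * ε
      bound true _ = ℚP.≤-reflexive (trans (𝔼-const D (proj₂ dist) 0ℚ) (sym (ℚP.*-zeroˡ ε)))
      bound false fx≡false =
        subst₂ _≤_ (∑-cong D λ p → cong (λ e → proj₁ p * 𝟙 e) (not-≡ᵇ-false (eval (proj₂ p) x)))
                   (sym (ℚP.*-identityˡ ε))
                   (errorProb-at≤ε x false fx≡false)
        where
        not-≡ᵇ-false : ∀ e → not (boolEq e false) ≡ e
        not-≡ᵇ-false true = refl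
        not-≡ᵇ-false false = refl

    member-error : ∀ i → 𝔼 D (λ T → mass (members (V i)) [] (λ y → not (eval T y))) ≤ ℕ→ℚ (2 ^ Subspace.k (V i)) * ε
    member-error i = begin
      𝔼 D (λ T → mass (members (V i)) [] (λ y → not (eval T y)))
        ≡⟨ 𝔼-∑ D (members (V i)) (λ y T → 𝟙 (not (eval T y))) ⟩
      ∑[ y ∈ members (V i) ] 𝔼 D (λ T → 𝟙 (not (eval T y)))
        ≡⟨ ∑-map (λ c → lincomb (lookup c) g) (allVecs k) (λ y → 𝔼 D (λ T → 𝟙 (not (eval T y)))) ⟩
      ∑[ c ∈ allVecs k ] 𝔼 D (λ T → 𝟙 (not (eval T (lincomb (lookup c) g))))
        ≤⟨ ∑-mono-≤ (All.universal (λ c → point-error (lincomb (lookup c) g)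
                                              (Equivalence.from (hf _) (i , lookup c , refl))) (allVecs k)) ⟩
      ∑[ c ∈ allVecs k ] ε
        ≡⟨ ∑-const (allVecs k) ε ⟩
      ℕ→ℚ (L.length (allVecs k)) * ε
        ≡⟨ cong (λ l → ℕ→ℚ l * ε) (length-allVecs k) ⟩
      ℕ→ℚ (2 ^ k) * ε ∎
      where
      open ℚP.≤-Reasoning
      k = Subspace.k (V i)
      g = Subspace.gen (V i)
      point-error : ∀ y → f y ≡ true → 𝔼 D (λ T → 𝟙 (not (eval T y))) ≤ ε
      point-error y fy≡true =
        subst (_≤ ε) (∑-cong D λ p → cong (λ e → proj₁ p * 𝟙 (not e)) (≡ᵇ-true (eval (proj₂ p) y)))
              (errorProb-at≤ε y true fy≡true)
        where
        ≡ᵇ-true : ∀ e → boolEq e true ≡ e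
        ≡ᵇ-true true = refl
        ≡ᵇ-true false = refl

    expectedLoss-upper : 𝔼 D (loss []) ≤ ℕ→ℚ m * (mass (allVecs n) [] falseAt * ε) + ℕ→ℚ m * (ℕ→ℚ (2 ^ n) * ε)
    expectedLoss-upper = begin
      𝔼 D (loss [])
        ≡⟨ 𝔼-+ D (λ T → ℕ→ℚ m * zeros T) (λ T → ∑[ i ∈ L.allFin m ] (weight (V i) * ones i T)) ⟩
      𝔼 D (λ T → ℕ→ℚ m * zeros T) + 𝔼 D (λ T → ∑[ i ∈ L.allFin m ] (weight (V i) * ones i T))
        ≡⟨ cong₂ _+_ (𝔼-*ˡ D (ℕ→ℚ m) zeros)
                     (trans (𝔼-∑ D (L.allFin m) λ i T → weight (V i) * ones i T)
                            (∑-cong (L.allFin m) λ i → 𝔼-*ˡ D (weight (V i)) (ones i))) ⟩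
      ℕ→ℚ m * 𝔼 D zeros + ∑[ i ∈ L.allFin m ] (weight (V i) * 𝔼 D (ones i))
        ≤⟨ ℚP.+-mono-≤ (*-monoˡ-≤-nonNeg′ (ℕ→ℚ-nonNeg m) zeros-error)
                       (∑-mono-≤ (All.universal (λ i → *-monoˡ-≤-nonNeg′ (weight-nonNeg (V i)) (member-error i))
                                                (L.allFin m))) ⟩
      ℕ→ℚ m * (Z * ε) + ∑[ i ∈ L.allFin m ] (weight (V i) * (ℕ→ℚ (2 ^ Subspace.k (V i)) * ε))
        ≡⟨ cong (ℕ→ℚ m * (Z * ε) +_) ones-total ⟩
      ℕ→ℚ m * (Z * ε) + ℕ→ℚ m * (ℕ→ℚ (2 ^ n) * ε) ∎
      where
      open ℚP.≤-Reasoning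
      zeros : PDT n → ℚ
      zeros T = mass (allVecs n) [] (λ x → falseAt x ∧ eval T x)
      ones : Fin m → PDT n → ℚ
      ones i T = mass (members (V i)) [] (λ y → not (eval T y))
      Z = mass (allVecs n) [] falseAt
      zeros-error : 𝔼 D zeros ≤ Z * ε
      zeros-error = begin
        𝔼 D zeros                                                  ≡⟨ 𝔼-∑ D (allVecs n) (λ x T → 𝟙 (falseAt x ∧ eval T x)) ⟩
        ∑[ x ∈ allVecs n ] 𝔼 D (λ T → 𝟙 (falseAt x ∧ eval T x))    ≤⟨ ∑-mono-≤ (All.universal zero-error (allVecs n)) ⟩
        ∑[ x ∈ allVecs n ] (𝟙 (falseAt x) * ε)                     ≡⟨ ∑-*ʳ (allVecs n) ε (𝟙 ∘ falseAt) ⟩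
        Z * ε                                                      ∎
      ones-total : ∑[ i ∈ L.allFin m ] (weight (V i) * (ℕ→ℚ (2 ^ Subspace.k (V i)) * ε)) ≡
                   ℕ→ℚ m * (ℕ→ℚ (2 ^ n) * ε)
      ones-total = begin-equality
        ∑[ i ∈ L.allFin m ] (weight (V i) * (ℕ→ℚ (2 ^ Subspace.k (V i)) * ε))
          ≡⟨ ∑-cong (L.allFin m) (λ i → trans (sym (ℚP.*-assoc (weight (V i)) _ ε))
                                              (cong (_* ε) (weight-*-2^k (V i)))) ⟩
        ∑[ i ∈ L.allFin m ] (ℕ→ℚ (2 ^ n) * ε)
          ≡⟨ ∑-const (L.allFin m) (ℕ→ℚ (2 ^ n) * ε) ⟩
        ℕ→ℚ (L.length (L.allFin m)) * (ℕ→ℚ (2 ^ n) * ε)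
          ≡⟨ cong (λ l → ℕ→ℚ l * (ℕ→ℚ (2 ^ n) * ε)) (length-tabulate {n = m} (λ i → i)) ⟩
        ℕ→ℚ m * (ℕ→ℚ (2 ^ n) * ε) ∎

mainTheorem8 : (n s h m : ℕ) (V : Fin m → Subspace n) →
    IsDualSubspaceDesign s h V →
    (f : 𝔽₂^ n → Bool) →
    (∀ x → (f x ≡ true) ⇔ (∃ λ i → x ∈S V i)) →
    (ε : ℚ) →
    -- ε < (m - h)/(8m) · |f⁻¹(0)|/2ⁿ, with denominators cleared
    ε * (ℕ→ℚ (8 Data.Nat.* m) * ℕ→ℚ (2 ^ n)) < (ℕ→ℚ m - ℕ→ℚ h) * ℕ→ℚ (zeroCount f) →
    ¬ (∃ λ (D : RPDT n) → IsDistribution D × CostBelow s D × ComputesWithError f ε D)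
mainTheorem8 n s h m V design f hf ε ε-small (D , dist , cost , computes) =
  ℚP.<-irrefl refl (ℚP.<-≤-trans ε-small (begin
    (ℕ→ℚ m - ℕ→ℚ h) * ℕ→ℚ (zeroCount f)          ≡⟨ cong ((ℕ→ℚ m - ℕ→ℚ h) *_) (sym (∑-𝟙 falseAt (allVecs n))) ⟩
    (ℕ→ℚ m - ℕ→ℚ h) * Z                          ≤⟨ expectedLoss-lower D dist design cost ⟩
    𝔼 D (loss [])                                 ≤⟨ expectedLoss-upper D dist hf computes ⟩
    ℕ→ℚ m * (Z * ε) + ℕ→ℚ m * (ℕ→ℚ (2 ^ n) * ε)   ≤⟨ ≤-8·m·p·ε m (2 ^ n) 0≤ε Z≤2^n ⟩
    ε * (ℕ→ℚ (8 ℕ.* m) * ℕ→ℚ (2 ^ n))            ∎))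
  where
  open HardDistribution V f
  open ℚP.≤-Reasoning
  Z = mass (allVecs n) [] falseAt
  Z≤2^n : Z ≤ ℕ→ℚ (2 ^ n)
  Z≤2^n = ℚP.≤-trans (mass-≤-true (allVecs n) [] falseAt) (ℚP.≤-reflexive (∑1-allVecs n))
  0≤ε : 0ℚ ≤ ε
  0≤ε = computesWithError⇒0≤ε D dist computes
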